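{- Let $d$ be a positive integer. For every positive integer $n$: the number of partitions of size $n$ of dimension $m\ge2$ with $\lambda_1+d=\lambda_2+\lambda_m$ equals the number of partitions of size $n$ with $k_1>k_m$ and $\lambda_{m-1}=\lambda_m+d$. Similarly, the number of partitions of size $n$ of dimension $m\ge2$ with $\lambda_1=\lambda_2+\lambda_m+d$ equals the number of partitions of size $n$ with $k_1<k_m$ and $\lambda_1=\lambda_2+d$.
   Context: A partition is written $(\lambda_1,\dots,\lambda_m)\times[k_1,\dots,k_m]$, where $m\ge1$, the parts $\lambda_i$ are integers with $\lambda_1>\dots>\lambda_m>0$ and the multiplicities $k_i$ are positive integers; $m$ is its dimension and $\sum k_i\lambda_i$ its size. When $m=2$, the expression $\lambda_2+\lambda_m$ means $2\lambda_2$ and $\lambda_{m-1}$ means $\lambda_1$. -}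

module Defs where

open import Data.Nat using (ℕ; zero; suc; _+_; _*_; _<_; _≤_)
open import Data.Product using (_×_; _,_; proj₁; proj₂; Σ)
open import Data.List using (List; []; _∷_; length)
open import Data.List.Relation.Unary.All using (All)
open import Data.List.Relation.Unary.Linked using (Linked)
open import Relation.Binary.PropositionalEquality using (_≡_)
open import Function.Bundles using (_↔_)

-- A partition (λ₁,…,λₘ)×[k₁,…,kₘ] is represented by the list
-- ((λ₁ , k₁) ∷ … ∷ (λₘ , kₘ) ∷ []) of (part , multiplicity) pairs.
Block : Set
Block = ℕ × ℕ

part : Block → ℕ
part = proj₁

mult : Block → ℕ
mult = proj₂

record IsPartition (bs : List Block) : Set where
  field
    nonEmpty   : 1 ≤ length bs
    decreasing : Linked (λ a b → part b < part a) bs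
    positive   : All (λ b → 0 < part b × 0 < mult b) bs

record Partition : Set where
  constructor mkPartition
  field
    blocks : List Block
    wf     : IsPartition blocks
open Partition public

dim : Partition → ℕ
dim p = length (blocks p)

sizeL : List Block → ℕ
sizeL []             = 0
sizeL ((l , k) ∷ bs) = k * l + sizeL bs

size : Partition → ℕ
size p = sizeL (blocks p)

-- accessors (default value 0 only on lists too short for the index;
-- such cases never arise where they are used)
firstL : List Block → Block
firstL []      = (0 , 0)
firstL (b ∷ _) = b

secondL : List Block → Block
secondL (_ ∷ b ∷ _) = b
secondL _           = (0 , 0)

lastL : List Block → Block
lastL []           = (0 , 0)
lastL (b ∷ [])     = b
lastL (_ ∷ c ∷ bs) = lastL (c ∷ bs)

penultL : List Block → Block
penultL []               = (0 , 0)
penultL (_ ∷ [])         = (0 , 0)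
penultL (b ∷ _ ∷ [])     = b
penultL (_ ∷ c ∷ d ∷ bs) = penultL (c ∷ d ∷ bs)

λ₁ λ₂ λₘ λₘ₋₁ k₁ kₘ : Partition → ℕ
λ₁   p = part (firstL (blocks p))
λ₂   p = part (secondL (blocks p))
λₘ   p = part (lastL (blocks p))
λₘ₋₁ p = part (penultL (blocks p))
k₁   p = mult (firstL (blocks p))
kₘ   p = mult (lastL (blocks p))

-- "the number of partitions of size n satisfying P equals the number
-- satisfying Q": the two (finite) sets are in bijection.
SameCount : (Partition → Set) → (Partition → Set) → Set
SameCount P Q = Σ Partition P ↔ Σ Partition Q

{-# OPTIONS --safe #-}
module Submission where

-- Both identities come from explicit bijections that cut each of the k₁ largest parts in two.
-- In the first, λ₁ = λ₂ + (λ₁ − λ₂): the pieces λ₂ join the second block, whose multiplicity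
-- becomes k₂ + k₁, and the pieces λ₁ − λ₂ = λₘ − d form a new smallest block of multiplicity
-- k₁ < k₂ + k₁, lying d below the old λₘ, which is now the penultimate part.
-- In the second, λ₁ = (λ₁ − λₘ) + λₘ: the pieces λₘ join the last block, whose multiplicity
-- becomes kₘ + k₁ > k₁, and the first part becomes λ₁ − λₘ = λ₂ + d.
-- The inverses glue the pieces back together; d ≥ 1 keeps the new parts strictly decreasing.

open import Defs
open import Data.Empty using (⊥-elim)
open import Data.List using (List; []; _∷_; _∷ʳ_; length; initLast; _∷ʳ′_)
open import Data.List.Relation.Unary.All as All using (All; []; _∷_)
import Data.List.Relation.Unary.All.Properties as AllP
open import Data.List.Relation.Unary.Linked as Linked using (Linked; []; [-]; _∷_)
open import Data.Nat using (ℕ; _+_; _*_; _∸_; _<_; _≤_; _>_; z≤n; s≤s)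
open import Data.Nat.Properties
open import Algebra.Properties.CommutativeSemigroup +-commutativeSemigroup using (xy∙z≈xz∙y)
open import Data.Nat.Tactic.RingSolver using (solve-∀)
open import Data.Product using (Σ; _×_; _,_; proj₁; proj₂; uncurry)
open import Function.Bundles using (_↔_; mk↔ₛ′)
open import Relation.Binary.PropositionalEquality
  using (_≡_; refl; sym; trans; cong; cong₂; subst; module ≡-Reasoning)
open import Relation.Nullary.Irrelevant using (Irrelevant)

_≻_ : Block → Block → Set
a ≻ b = part b < part a

Positive : Block → Set
Positive b = 0 < part b × 0 < mult b

×-irrelevant : {A B : Set} → Irrelevant A → Irrelevant B → Irrelevant (A × B)
×-irrelevant irrA irrB (a , b) (a′ , b′) = cong₂ _,_ (irrA a a′) (irrB b b′)

IsPartition-irrelevant : ∀ {bs} → Irrelevant (IsPartition bs)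
IsPartition-irrelevant
  record { nonEmpty = ne  ; decreasing = dec  ; positive = pos  }
  record { nonEmpty = ne′ ; decreasing = dec′ ; positive = pos′ }
  with ≤-irrelevant ne ne′ | Linked.irrelevant <-irrelevant dec dec′
     | All.irrelevant (×-irrelevant <-irrelevant <-irrelevant) pos pos′
... | refl | refl | refl = refl

Σ-Partition-≡ : {P : Partition → Set} → (∀ p → Irrelevant (P p)) →
                {x y : Σ Partition P} → blocks (proj₁ x) ≡ blocks (proj₁ y) → x ≡ y
Σ-Partition-≡ irrP {mkPartition bs w , px} {mkPartition .bs w′ , py} refl
  with IsPartition-irrelevant w w′
... | refl = cong (mkPartition bs w ,_) (irrP _ px py)

IsPartitionWith : (Partition → Set) → List Block → Set
IsPartitionWith Q bs = Σ (IsPartition bs) (λ w → Q (mkPartition bs w))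

_⇒[_]_ : (Partition → Set) → (List Block → List Block) → (Partition → Set) → Set
P ⇒[ f ] Q = ∀ {bs} (w : IsPartition bs) → P (mkPartition bs w) → IsPartitionWith Q (f bs)

InverseOn : (Partition → Set) → (List Block → List Block) → (List Block → List Block) → Set
InverseOn P g f = ∀ {bs} (w : IsPartition bs) → P (mkPartition bs w) → g (f bs) ≡ bs

↔-fromBlockMaps : {P Q : Partition → Set} {f g : List Block → List Block} →
  (∀ p → Irrelevant (P p)) → (∀ p → Irrelevant (Q p)) →
  P ⇒[ f ] Q → Q ⇒[ g ] P → InverseOn P g f → InverseOn Q f g →
  Σ Partition P ↔ Σ Partition Q
↔-fromBlockMaps {P} {Q} {f} {g} irrP irrQ f-maps g-maps g∘f f∘g =
  mk↔ₛ′ to from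
    (λ { (mkPartition _ w , q) → Σ-Partition-≡ irrQ (f∘g w q) })
    (λ { (mkPartition _ w , p) → Σ-Partition-≡ irrP (g∘f w p) })
  where
  to : Σ Partition P → Σ Partition Q
  to (mkPartition bs w , p) = mkPartition (f bs) (proj₁ (f-maps w p)) , proj₂ (f-maps w p)
  from : Σ Partition Q → Σ Partition P
  from (mkPartition bs w , q) = mkPartition (g bs) (proj₁ (g-maps w q)) , proj₂ (g-maps w q)

initL : List Block → List Block
initL []           = []
initL (_ ∷ [])     = []
initL (x ∷ y ∷ ys) = x ∷ initL (y ∷ ys)

lastL-∷ʳ : ∀ xs x → lastL (xs ∷ʳ x) ≡ x
lastL-∷ʳ []           x = refl
lastL-∷ʳ (_ ∷ [])     x = refl
lastL-∷ʳ (_ ∷ y ∷ ys) x = lastL-∷ʳ (y ∷ ys) x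

initL-∷ʳ : ∀ xs x → initL (xs ∷ʳ x) ≡ xs
initL-∷ʳ []           x = refl
initL-∷ʳ (_ ∷ [])     x = refl
initL-∷ʳ (y ∷ z ∷ zs) x = cong (y ∷_) (initL-∷ʳ (z ∷ zs) x)

penultL-∷ʳ : ∀ x xs y → penultL (x ∷ xs ∷ʳ y) ≡ lastL (x ∷ xs)
penultL-∷ʳ x []           y = refl
penultL-∷ʳ x (_ ∷ [])     y = refl
penultL-∷ʳ x (z ∷ w ∷ ws) y = penultL-∷ʳ z (w ∷ ws) y

secondL-∷-∷ʳ-part : ∀ x ys z {x′ z′} → part z ≡ part z′ →
  part (secondL (x ∷ ys ∷ʳ z)) ≡ part (secondL (x′ ∷ ys ∷ʳ z′))
secondL-∷-∷ʳ-part x []      z eq = eq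
secondL-∷-∷ʳ-part x (_ ∷ _) z eq = refl

lastL-∷-part : ∀ l {k k′} xs → part (lastL ((l , k) ∷ xs)) ≡ part (lastL ((l , k′) ∷ xs))
lastL-∷-part l []      = refl
lastL-∷-part l (_ ∷ _) = refl

length-∷-∷ʳ : {A : Set} (x : A) (xs : List A) (y : A) → 2 ≤ length (x ∷ xs ∷ʳ y)
length-∷-∷ʳ x []      y = s≤s (s≤s z≤n)
length-∷-∷ʳ x (_ ∷ _) y = s≤s (s≤s z≤n)

sizeL-∷ʳ : ∀ xs l k → sizeL (xs ∷ʳ (l , k)) ≡ sizeL xs + k * l
sizeL-∷ʳ []             l k = +-comm (k * l) 0
sizeL-∷ʳ ((l′ , k′) ∷ xs) l k =
  trans (cong (k′ * l′ +_) (sizeL-∷ʳ xs l k)) (sym (+-assoc (k′ * l′) _ _))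

module _ {R : Block → Block → Set} where

  Linked-∷ʳ⁺ : ∀ x xs y → Linked R (x ∷ xs) → R (lastL (x ∷ xs)) y → Linked R (x ∷ xs ∷ʳ y)
  Linked-∷ʳ⁺ x []       y [-]        r = r ∷ [-]
  Linked-∷ʳ⁺ x (z ∷ zs) y (h ∷ rest) r = h ∷ Linked-∷ʳ⁺ z zs y rest r

  Linked-∷ʳ⁻ : ∀ x xs y → Linked R (x ∷ xs ∷ʳ y) → Linked R (x ∷ xs) × R (lastL (x ∷ xs)) y
  Linked-∷ʳ⁻ x []       y (r ∷ [-])  = [-] , r
  Linked-∷ʳ⁻ x (z ∷ zs) y (h ∷ rest) with Linked-∷ʳ⁻ z zs y rest
  ... | lk , r = h ∷ lk , r

Linked-∷-≤ : ∀ {x x′ xs} → part x ≤ part x′ → Linked _≻_ (x ∷ xs) → Linked _≻_ (x′ ∷ xs)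
Linked-∷-≤ le [-]        = [-]
Linked-∷-≤ le (h ∷ rest) = <-≤-trans h le ∷ rest

Linked-∷-replace : ∀ {x x′ xs} → part (secondL (x ∷ xs)) < part x′ →
                   Linked _≻_ (x ∷ xs) → Linked _≻_ (x′ ∷ xs)
Linked-∷-replace lt [-]        = [-]
Linked-∷-replace lt (_ ∷ rest) = lt ∷ rest

IsPartition-replaceEnds : ∀ x ys z {x′ k′} → IsPartition (x ∷ ys ∷ʳ z) →
  Positive x′ → 0 < k′ → part (secondL (x ∷ ys ∷ʳ z)) < part x′ →
  IsPartition (x′ ∷ ys ∷ʳ (part z , k′))
IsPartition-replaceEnds x ys z {x′} {k′} w pos-x′ k′>0 lt = record
  { nonEmpty   = s≤s z≤n
  ; decreasing = uncurry (Linked-∷ʳ⁺ x′ ys (part z , k′))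
                   (Linked-∷ʳ⁻ x′ ys z (Linked-∷-replace lt (IsPartition.decreasing w)))
  ; positive   = pos-x′ ∷ AllP.++⁺ (AllP.++⁻ˡ ys pos) ((proj₁ pos-z , k′>0) ∷ [])
  }
  where
  pos = All.tail (IsPartition.positive w)
  pos-z = All.head (AllP.++⁻ʳ ys pos)

m+o≡n+p⇒p≡m∸n+o : ∀ {m n o p} → n ≤ m → m + o ≡ n + p → p ≡ m ∸ n + o
m+o≡n+p⇒p≡m∸n+o {m} {n} {o} {p} n≤m eq = begin
  p             ≡⟨ sym (m+n∸m≡n n p) ⟩
  n + p ∸ n     ≡⟨ cong (_∸ n) (sym eq) ⟩
  m + o ∸ n     ≡⟨ +-∸-comm o n≤m ⟩
  m ∸ n + o     ∎
  where open ≡-Reasoning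

splitFirstBySecond : List Block → List Block
splitFirstBySecond ((l₁ , k₁) ∷ (l₂ , k₂) ∷ bs) = (l₂ , k₂ + k₁) ∷ bs ∷ʳ (l₁ ∸ l₂ , k₁)
splitFirstBySecond bs = bs

joinLastToFirst : List Block → List Block
joinLastToFirst []             = []
joinLastToFirst ((l , k) ∷ bs) =
  (l + part (lastL bs) , mult (lastL bs)) ∷ (l , k ∸ mult (lastL bs)) ∷ initL bs

joinLastToFirst-∷ʳ : ∀ l k ys lₘ kₘ →
  joinLastToFirst ((l , k) ∷ ys ∷ʳ (lₘ , kₘ)) ≡ (l + lₘ , kₘ) ∷ (l , k ∸ kₘ) ∷ ys
joinLastToFirst-∷ʳ l k ys lₘ kₘ rewrite lastL-∷ʳ ys (lₘ , kₘ) | initL-∷ʳ ys (lₘ , kₘ) = refl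

sizeL-splitFirstBySecond : ∀ l e k k′ bs →
  sizeL ((l , k′ + k) ∷ bs ∷ʳ (e , k)) ≡ sizeL ((l + e , k) ∷ (l , k′) ∷ bs)
sizeL-splitFirstBySecond l e k k′ bs =
  trans (cong ((k′ + k) * l +_) (sizeL-∷ʳ bs e k)) (regroup k k′ l e (sizeL bs))
  where
  regroup : ∀ k k′ l e s → (k′ + k) * l + (s + k * e) ≡ k * (l + e) + (k′ * l + s)
  regroup = solve-∀

joinLastToFirst∘splitFirstBySecond : ∀ {l₁ k₁ l₂ k₂} bs → l₂ ≤ l₁ →
  joinLastToFirst (splitFirstBySecond ((l₁ , k₁) ∷ (l₂ , k₂) ∷ bs)) ≡ (l₁ , k₁) ∷ (l₂ , k₂) ∷ bs
joinLastToFirst∘splitFirstBySecond {l₁} {k₁} {l₂} {k₂} bs l₂≤l₁ =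
  trans (joinLastToFirst-∷ʳ l₂ (k₂ + k₁) bs (l₁ ∸ l₂) k₁)
        (cong₂ (λ l k → (l , k₁) ∷ (l₂ , k) ∷ bs) (m+[n∸m]≡n l₂≤l₁) (m+n∸n≡m k₂ k₁))

splitFirstBySecond∘joinLastToFirst : ∀ {l k lₘ kₘ} ys → kₘ ≤ k →
  splitFirstBySecond (joinLastToFirst ((l , k) ∷ ys ∷ʳ (lₘ , kₘ))) ≡ (l , k) ∷ ys ∷ʳ (lₘ , kₘ)
splitFirstBySecond∘joinLastToFirst {l} {k} {lₘ} {kₘ} ys kₘ≤k =
  trans (cong splitFirstBySecond (joinLastToFirst-∷ʳ l k ys lₘ kₘ))
        (cong₂ (λ k′ l′ → (l , k′) ∷ ys ∷ʳ (l′ , kₘ)) (m∸n+n≡m kₘ≤k) (m+n∸m≡n l lₘ))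

splitFirstBySecond-isPartition : ∀ {l₁ k₁ l₂ k₂} bs → IsPartition ((l₁ , k₁) ∷ (l₂ , k₂) ∷ bs) →
  l₁ ∸ l₂ < part (lastL ((l₂ , k₂) ∷ bs)) →
  IsPartition (splitFirstBySecond ((l₁ , k₁) ∷ (l₂ , k₂) ∷ bs))
splitFirstBySecond-isPartition {l₁} {k₁} {l₂} {k₂} bs w lt = record
  { nonEmpty   = s≤s z≤n
  ; decreasing = Linked-∷ʳ⁺ (l₂ , k₂ + k₁) bs (l₁ ∸ l₂ , k₁)
                   (Linked-∷-≤ ≤-refl (Linked.tail lk)) (subst (l₁ ∸ l₂ <_) (lastL-∷-part l₂ bs) lt)
  ; positive   = (proj₁ pos₂ , <-≤-trans (proj₂ pos₂) (m≤m+n k₂ k₁))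
                 ∷ AllP.++⁺ (All.tail (All.tail pos)) ((m<n⇒0<n∸m (Linked.head lk) , proj₂ (All.head pos)) ∷ [])
  }
  where
  lk = IsPartition.decreasing w
  pos = IsPartition.positive w
  pos₂ = All.head (All.tail pos)

joinLastToFirst-isPartition : ∀ {l k lₘ kₘ} ys → IsPartition ((l , k) ∷ ys ∷ʳ (lₘ , kₘ)) → kₘ < k →
  IsPartition ((l + lₘ , kₘ) ∷ (l , k ∸ kₘ) ∷ ys)
joinLastToFirst-isPartition {l} {k} {lₘ} {kₘ} ys w kₘ<k = record
  { nonEmpty   = s≤s z≤n
  ; decreasing = m<m+n l (proj₁ pos-last)
                 ∷ Linked-∷-≤ ≤-refl (proj₁ (Linked-∷ʳ⁻ (l , k) ys (lₘ , kₘ) (IsPartition.decreasing w)))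
  ; positive   = (<-≤-trans (proj₁ pos-first) (m≤m+n l lₘ) , proj₂ pos-last)
                 ∷ (proj₁ pos-first , m<n⇒0<n∸m kₘ<k) ∷ AllP.++⁻ˡ ys (All.tail pos)
  }
  where
  pos = IsPartition.positive w
  pos-first = All.head pos
  pos-last = All.head (AllP.++⁻ʳ ys (All.tail pos))

module FirstIdentity (d : ℕ) (d≥1 : 1 ≤ d) (n : ℕ) where

  Left Right : Partition → Set
  Left  p = size p ≡ n × 2 ≤ dim p × λ₁ p + d ≡ λ₂ p + λₘ p
  Right p = size p ≡ n × k₁ p > kₘ p × λₘ₋₁ p ≡ λₘ p + d

  Left-irrelevant : ∀ p → Irrelevant (Left p)
  Left-irrelevant p = ×-irrelevant ≡-irrelevant (×-irrelevant ≤-irrelevant ≡-irrelevant)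

  Right-irrelevant : ∀ p → Irrelevant (Right p)
  Right-irrelevant p = ×-irrelevant ≡-irrelevant (×-irrelevant <-irrelevant ≡-irrelevant)

  split-maps : Left ⇒[ splitFirstBySecond ] Right
  split-maps {[]}    w (_ , () , _)
  split-maps {_ ∷ []} w (_ , s≤s () , _)
  split-maps {(l₁ , k₁) ∷ (l₂ , k₂) ∷ bs} w (size≡n , _ , gap) =
    splitFirstBySecond-isPartition bs w (subst (l₁ ∸ l₂ <_) (sym lₘ≡) (m<m+n (l₁ ∸ l₂) d≥1)) ,
    size′≡n , kₘ′<k₁′ , penult≡
    where
    open ≡-Reasoning
    l₂<l₁ = Linked.head (IsPartition.decreasing w)
    k₂>0 = proj₂ (All.head (All.tail (IsPartition.positive w)))
    lₘ = part (lastL ((l₂ , k₂) ∷ bs))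
    x = (l₁ ∸ l₂ , k₁)
    last-x = lastL-∷ʳ ((l₂ , k₂ + k₁) ∷ bs) x
    lₘ≡ : lₘ ≡ l₁ ∸ l₂ + d
    lₘ≡ = m+o≡n+p⇒p≡m∸n+o (<⇒≤ l₂<l₁) gap
    size′≡n : sizeL ((l₂ , k₂ + k₁) ∷ bs ∷ʳ x) ≡ n
    size′≡n = begin
      sizeL ((l₂ , k₂ + k₁) ∷ bs ∷ʳ x)                ≡⟨ sizeL-splitFirstBySecond l₂ (l₁ ∸ l₂) k₁ k₂ bs ⟩
      sizeL ((l₂ + (l₁ ∸ l₂) , k₁) ∷ (l₂ , k₂) ∷ bs)  ≡⟨ cong (λ l → sizeL ((l , k₁) ∷ (l₂ , k₂) ∷ bs)) (m+[n∸m]≡n (<⇒≤ l₂<l₁)) ⟩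
      sizeL ((l₁ , k₁) ∷ (l₂ , k₂) ∷ bs)              ≡⟨ size≡n ⟩
      n                                               ∎
    kₘ′<k₁′ : mult (lastL ((l₂ , k₂ + k₁) ∷ bs ∷ʳ x)) < k₂ + k₁
    kₘ′<k₁′ = subst (λ b → mult b < k₂ + k₁) (sym last-x) (m<n+m k₁ k₂>0)
    penult≡ : part (penultL ((l₂ , k₂ + k₁) ∷ bs ∷ʳ x)) ≡ part (lastL ((l₂ , k₂ + k₁) ∷ bs ∷ʳ x)) + d
    penult≡ = begin
      part (penultL ((l₂ , k₂ + k₁) ∷ bs ∷ʳ x))   ≡⟨ cong part (penultL-∷ʳ (l₂ , k₂ + k₁) bs x) ⟩
      part (lastL ((l₂ , k₂ + k₁) ∷ bs))          ≡⟨ lastL-∷-part l₂ bs ⟩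
      lₘ                                          ≡⟨ lₘ≡ ⟩
      l₁ ∸ l₂ + d                                 ≡⟨ cong (λ b → part b + d) (sym last-x) ⟩
      part (lastL ((l₂ , k₂ + k₁) ∷ bs ∷ʳ x)) + d ∎

  join-maps : Right ⇒[ joinLastToFirst ] Left
  join-maps {[]} w (_ , () , _)
  join-maps {(l , k) ∷ t} w q with initLast t
  join-maps {(l , k) ∷ _} w (_ , k<k , _) | [] = ⊥-elim (<-irrefl refl k<k)
  join-maps {(l , k) ∷ _} w (size≡n , kₘ<k , penult≡) | ys ∷ʳ′ (lₘ , kₘ) =
    subst (IsPartitionWith Left) (sym (joinLastToFirst-∷ʳ l k ys lₘ kₘ))
      (joinLastToFirst-isPartition ys w kₘ<k′ , size′≡n , s≤s (s≤s z≤n) , gap)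
    where
    open ≡-Reasoning
    last-z = lastL-∷ʳ ((l , k) ∷ ys) (lₘ , kₘ)
    kₘ<k′ : kₘ < k
    kₘ<k′ = subst (λ b → mult b < k) last-z kₘ<k
    size′≡n : sizeL ((l + lₘ , kₘ) ∷ (l , k ∸ kₘ) ∷ ys) ≡ n
    size′≡n = begin
      sizeL ((l + lₘ , kₘ) ∷ (l , k ∸ kₘ) ∷ ys)   ≡⟨ sym (sizeL-splitFirstBySecond l lₘ kₘ (k ∸ kₘ) ys) ⟩
      sizeL ((l , k ∸ kₘ + kₘ) ∷ ys ∷ʳ (lₘ , kₘ)) ≡⟨ cong (λ k′ → sizeL ((l , k′) ∷ ys ∷ʳ (lₘ , kₘ))) (m∸n+n≡m (<⇒≤ kₘ<k′)) ⟩
      sizeL ((l , k) ∷ ys ∷ʳ (lₘ , kₘ))           ≡⟨ size≡n ⟩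
      n                                           ∎
    gap : l + lₘ + d ≡ l + part (lastL ((l , k ∸ kₘ) ∷ ys))
    gap = begin
      l + lₘ + d                                       ≡⟨ +-assoc l lₘ d ⟩
      l + (lₘ + d)                                     ≡⟨ cong (λ b → l + (part b + d)) (sym last-z) ⟩
      l + (part (lastL ((l , k) ∷ ys ∷ʳ (lₘ , kₘ))) + d) ≡⟨ cong (l +_) (sym penult≡) ⟩
      l + part (penultL ((l , k) ∷ ys ∷ʳ (lₘ , kₘ)))   ≡⟨ cong (λ b → l + part b) (penultL-∷ʳ (l , k) ys (lₘ , kₘ)) ⟩
      l + part (lastL ((l , k) ∷ ys))                  ≡⟨ cong (l +_) (lastL-∷-part l ys) ⟩
      l + part (lastL ((l , k ∸ kₘ) ∷ ys)) ∎

  join∘split : InverseOn Left joinLastToFirst splitFirstBySecond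
  join∘split {[]}    w (_ , () , _)
  join∘split {_ ∷ []} w (_ , s≤s () , _)
  join∘split {(l₁ , k₁) ∷ (l₂ , k₂) ∷ bs} w _ =
    joinLastToFirst∘splitFirstBySecond bs (<⇒≤ (Linked.head (IsPartition.decreasing w)))

  split∘join : InverseOn Right splitFirstBySecond joinLastToFirst
  split∘join {[]} w (_ , () , _)
  split∘join {(l , k) ∷ t} w q with initLast t
  split∘join {(l , k) ∷ _} w (_ , k<k , _) | [] = ⊥-elim (<-irrefl refl k<k)
  split∘join {(l , k) ∷ _} w (_ , kₘ<k , _) | ys ∷ʳ′ (lₘ , kₘ) =
    splitFirstBySecond∘joinLastToFirst ys
      (<⇒≤ (subst (λ b → mult b < k) (lastL-∷ʳ ((l , k) ∷ ys) (lₘ , kₘ)) kₘ<k))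

  bijection : Σ Partition Left ↔ Σ Partition Right
  bijection = ↔-fromBlockMaps Left-irrelevant Right-irrelevant split-maps join-maps join∘split split∘join

splitFirstByLast : List Block → List Block
splitFirstByLast []             = []
splitFirstByLast ((l , k) ∷ bs) =
  (l ∸ part (lastL bs) , k) ∷ initL bs ∷ʳ (part (lastL bs) , mult (lastL bs) + k)

joinFirstToLast : List Block → List Block
joinFirstToLast []             = []
joinFirstToLast ((l , k) ∷ bs) =
  (l + part (lastL bs) , k) ∷ initL bs ∷ʳ (part (lastL bs) , mult (lastL bs) ∸ k)

splitFirstByLast-∷ʳ : ∀ l k ys lₘ kₘ →
  splitFirstByLast ((l , k) ∷ ys ∷ʳ (lₘ , kₘ)) ≡ (l ∸ lₘ , k) ∷ ys ∷ʳ (lₘ , kₘ + k)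
splitFirstByLast-∷ʳ l k ys lₘ kₘ rewrite lastL-∷ʳ ys (lₘ , kₘ) | initL-∷ʳ ys (lₘ , kₘ) = refl

joinFirstToLast-∷ʳ : ∀ l k ys lₘ kₘ →
  joinFirstToLast ((l , k) ∷ ys ∷ʳ (lₘ , kₘ)) ≡ (l + lₘ , k) ∷ ys ∷ʳ (lₘ , kₘ ∸ k)
joinFirstToLast-∷ʳ l k ys lₘ kₘ rewrite lastL-∷ʳ ys (lₘ , kₘ) | initL-∷ʳ ys (lₘ , kₘ) = refl

sizeL-splitFirstByLast : ∀ l lₘ k kₘ ys →
  sizeL ((l + lₘ , k) ∷ ys ∷ʳ (lₘ , kₘ)) ≡ sizeL ((l , k) ∷ ys ∷ʳ (lₘ , kₘ + k))
sizeL-splitFirstByLast l lₘ k kₘ ys = begin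
  k * (l + lₘ) + sizeL (ys ∷ʳ (lₘ , kₘ))        ≡⟨ cong (k * (l + lₘ) +_) (sizeL-∷ʳ ys lₘ kₘ) ⟩
  k * (l + lₘ) + (sizeL ys + kₘ * lₘ)           ≡⟨ regroup k l lₘ kₘ (sizeL ys) ⟩
  k * l + (sizeL ys + (kₘ + k) * lₘ)            ≡⟨ cong (k * l +_) (sym (sizeL-∷ʳ ys lₘ (kₘ + k))) ⟩
  k * l + sizeL (ys ∷ʳ (lₘ , kₘ + k))           ∎
  where
  open ≡-Reasoning
  regroup : ∀ k l lₘ kₘ s → k * (l + lₘ) + (s + kₘ * lₘ) ≡ k * l + (s + (kₘ + k) * lₘ)
  regroup = solve-∀

joinFirstToLast∘splitFirstByLast : ∀ {l k lₘ kₘ} ys → lₘ ≤ l →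
  joinFirstToLast (splitFirstByLast ((l , k) ∷ ys ∷ʳ (lₘ , kₘ))) ≡ (l , k) ∷ ys ∷ʳ (lₘ , kₘ)
joinFirstToLast∘splitFirstByLast {l} {k} {lₘ} {kₘ} ys lₘ≤l =
  trans (cong joinFirstToLast (splitFirstByLast-∷ʳ l k ys lₘ kₘ))
    (trans (joinFirstToLast-∷ʳ (l ∸ lₘ) k ys lₘ (kₘ + k))
      (cong₂ (λ l′ k′ → (l′ , k) ∷ ys ∷ʳ (lₘ , k′)) (m∸n+n≡m lₘ≤l) (m+n∸n≡m kₘ k)))

splitFirstByLast∘joinFirstToLast : ∀ {l k lₘ kₘ} ys → k ≤ kₘ →
  splitFirstByLast (joinFirstToLast ((l , k) ∷ ys ∷ʳ (lₘ , kₘ))) ≡ (l , k) ∷ ys ∷ʳ (lₘ , kₘ)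
splitFirstByLast∘joinFirstToLast {l} {k} {lₘ} {kₘ} ys k≤kₘ =
  trans (cong splitFirstByLast (joinFirstToLast-∷ʳ l k ys lₘ kₘ))
    (trans (splitFirstByLast-∷ʳ (l + lₘ) k ys lₘ (kₘ ∸ k))
      (cong₂ (λ l′ k′ → (l′ , k) ∷ ys ∷ʳ (lₘ , k′)) (m+n∸n≡m l lₘ) (m∸n+n≡m k≤kₘ)))

module SecondIdentity (d : ℕ) (d≥1 : 1 ≤ d) (n : ℕ) where

  Left Right : Partition → Set
  Left  p = size p ≡ n × 2 ≤ dim p × λ₁ p ≡ λ₂ p + λₘ p + d
  Right p = size p ≡ n × k₁ p < kₘ p × λ₁ p ≡ λ₂ p + d

  Left-irrelevant : ∀ p → Irrelevant (Left p)
  Left-irrelevant p = ×-irrelevant ≡-irrelevant (×-irrelevant ≤-irrelevant ≡-irrelevant)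

  Right-irrelevant : ∀ p → Irrelevant (Right p)
  Right-irrelevant p = ×-irrelevant ≡-irrelevant (×-irrelevant <-irrelevant ≡-irrelevant)

  split-maps : Left ⇒[ splitFirstByLast ] Right
  split-maps {[]} w (_ , () , _)
  split-maps {(l , k) ∷ t} w q with initLast t
  split-maps {(l , k) ∷ _} w (_ , s≤s () , _) | []
  split-maps {(l , k) ∷ _} w (size≡n , _ , gap) | ys ∷ʳ′ (lₘ , kₘ) =
    subst (IsPartitionWith Right) (sym (splitFirstByLast-∷ʳ l k ys lₘ kₘ))
      ( IsPartition-replaceEnds (l , k) ys (lₘ , kₘ) w (l′>0 , proj₂ (All.head pos))
          (<-≤-trans kₘ>0 (m≤m+n kₘ k)) (subst (l₂ <_) (sym l∸lₘ≡) (m<m+n l₂ d≥1))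
      , size′≡n , k<kₘ′ , gap′ )
    where
    open ≡-Reasoning
    pos = IsPartition.positive w
    kₘ>0 = proj₂ (All.head (AllP.++⁻ʳ ys (All.tail pos)))
    l₂ = part (secondL ((l , k) ∷ ys ∷ʳ (lₘ , kₘ)))
    x′ = (l ∸ lₘ , k)
    z′ = (lₘ , kₘ + k)
    l≡ : l ≡ l₂ + lₘ + d
    l≡ = trans gap (cong (λ b → l₂ + part b + d) (lastL-∷ʳ ((l , k) ∷ ys) (lₘ , kₘ)))
    l∸lₘ≡ : l ∸ lₘ ≡ l₂ + d
    l∸lₘ≡ = trans (cong (_∸ lₘ) (trans l≡ (xy∙z≈xz∙y l₂ lₘ d))) (m+n∸n≡m (l₂ + d) lₘ)
    l′>0 : 0 < l ∸ lₘ
    l′>0 = subst (0 <_) (sym l∸lₘ≡) (<-≤-trans d≥1 (m≤n+m d l₂))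
    lₘ≤l : lₘ ≤ l
    lₘ≤l = subst (lₘ ≤_) (sym l≡) (≤-trans (m≤n+m lₘ l₂) (m≤m+n (l₂ + lₘ) d))
    size′≡n : sizeL (x′ ∷ ys ∷ʳ z′) ≡ n
    size′≡n = begin
      sizeL (x′ ∷ ys ∷ʳ z′)                         ≡⟨ sym (sizeL-splitFirstByLast (l ∸ lₘ) lₘ k kₘ ys) ⟩
      sizeL ((l ∸ lₘ + lₘ , k) ∷ ys ∷ʳ (lₘ , kₘ))  ≡⟨ cong (λ l′ → sizeL ((l′ , k) ∷ ys ∷ʳ (lₘ , kₘ))) (m∸n+n≡m lₘ≤l) ⟩
      sizeL ((l , k) ∷ ys ∷ʳ (lₘ , kₘ))            ≡⟨ size≡n ⟩
      n                                             ∎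
    k<kₘ′ : k < mult (lastL (x′ ∷ ys ∷ʳ z′))
    k<kₘ′ = subst (λ b → k < mult b) (sym (lastL-∷ʳ (x′ ∷ ys) z′)) (m<n+m k kₘ>0)
    gap′ : l ∸ lₘ ≡ part (secondL (x′ ∷ ys ∷ʳ z′)) + d
    gap′ = trans l∸lₘ≡ (cong (_+ d) (secondL-∷-∷ʳ-part (l , k) ys (lₘ , kₘ) refl))

  join-maps : Right ⇒[ joinFirstToLast ] Left
  join-maps {[]} w (_ , () , _)
  join-maps {(l , k) ∷ t} w q with initLast t
  join-maps {(l , k) ∷ _} w (_ , k<k , _) | [] = ⊥-elim (<-irrefl refl k<k)
  join-maps {(l , k) ∷ _} w (size≡n , k<kₘ , gap) | ys ∷ʳ′ (lₘ , kₘ) =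
    subst (IsPartitionWith Left) (sym (joinFirstToLast-∷ʳ l k ys lₘ kₘ))
      ( IsPartition-replaceEnds (l , k) ys (lₘ , kₘ) w (<-≤-trans l>0 (m≤m+n l lₘ) , proj₂ (All.head pos))
          (m<n⇒0<n∸m k<kₘ′) (<-≤-trans (subst (l₂ <_) (sym gap) (m<m+n l₂ d≥1)) (m≤m+n l lₘ))
      , size′≡n , length-∷-∷ʳ x′ ys z′ , gap′ )
    where
    open ≡-Reasoning
    pos = IsPartition.positive w
    l>0 = proj₁ (All.head pos)
    l₂ = part (secondL ((l , k) ∷ ys ∷ʳ (lₘ , kₘ)))
    x′ = (l + lₘ , k)
    z′ = (lₘ , kₘ ∸ k)
    k<kₘ′ : k < kₘ
    k<kₘ′ = subst (λ b → k < mult b) (lastL-∷ʳ ((l , k) ∷ ys) (lₘ , kₘ)) k<kₘ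
    size′≡n : sizeL (x′ ∷ ys ∷ʳ z′) ≡ n
    size′≡n = begin
      sizeL (x′ ∷ ys ∷ʳ z′)                         ≡⟨ sizeL-splitFirstByLast l lₘ k (kₘ ∸ k) ys ⟩
      sizeL ((l , k) ∷ ys ∷ʳ (lₘ , kₘ ∸ k + k))    ≡⟨ cong (λ k′ → sizeL ((l , k) ∷ ys ∷ʳ (lₘ , k′))) (m∸n+n≡m (<⇒≤ k<kₘ′)) ⟩
      sizeL ((l , k) ∷ ys ∷ʳ (lₘ , kₘ))            ≡⟨ size≡n ⟩
      n                                             ∎
    gap′ : l + lₘ ≡ part (secondL (x′ ∷ ys ∷ʳ z′)) + part (lastL (x′ ∷ ys ∷ʳ z′)) + d
    gap′ = begin
      l + lₘ                 ≡⟨ cong (_+ lₘ) gap ⟩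
      l₂ + d + lₘ            ≡⟨ xy∙z≈xz∙y l₂ d lₘ ⟩
      l₂ + lₘ + d            ≡⟨ cong₂ (λ a b → a + part b + d) (secondL-∷-∷ʳ-part (l , k) ys (lₘ , kₘ) refl)
                                      (sym (lastL-∷ʳ (x′ ∷ ys) z′)) ⟩
      part (secondL (x′ ∷ ys ∷ʳ z′)) + part (lastL (x′ ∷ ys ∷ʳ z′)) + d ∎

  join∘split : InverseOn Left joinFirstToLast splitFirstByLast
  join∘split {[]} w (_ , () , _)
  join∘split {(l , k) ∷ t} w q with initLast t
  join∘split {(l , k) ∷ _} w (_ , s≤s () , _) | []
  join∘split {(l , k) ∷ _} w (_ , _ , gap) | ys ∷ʳ′ (lₘ , kₘ) =
    joinFirstToLast∘splitFirstByLast ys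
      (subst (lₘ ≤_) (sym (trans gap (cong (λ b → l₂ + part b + d) (lastL-∷ʳ ((l , k) ∷ ys) (lₘ , kₘ)))))
             (≤-trans (m≤n+m lₘ l₂) (m≤m+n (l₂ + lₘ) d)))
    where l₂ = part (secondL ((l , k) ∷ ys ∷ʳ (lₘ , kₘ)))

  split∘join : InverseOn Right splitFirstByLast joinFirstToLast
  split∘join {[]} w (_ , () , _)
  split∘join {(l , k) ∷ t} w q with initLast t
  split∘join {(l , k) ∷ _} w (_ , k<k , _) | [] = ⊥-elim (<-irrefl refl k<k)
  split∘join {(l , k) ∷ _} w (_ , k<kₘ , _) | ys ∷ʳ′ (lₘ , kₘ) =
    splitFirstByLast∘joinFirstToLast ys
      (<⇒≤ (subst (λ b → k < mult b) (lastL-∷ʳ ((l , k) ∷ ys) (lₘ , kₘ)) k<kₘ))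

  bijection : Σ Partition Left ↔ Σ Partition Right
  bijection = ↔-fromBlockMaps Left-irrelevant Right-irrelevant split-maps join-maps join∘split split∘join

mainTheorem4 : (d : ℕ) → 1 ≤ d → (n : ℕ) → 1 ≤ n →
    SameCount (λ p → size p ≡ n × 2 ≤ dim p × λ₁ p + d ≡ λ₂ p + λₘ p)
              (λ p → size p ≡ n × k₁ p > kₘ p × λₘ₋₁ p ≡ λₘ p + d)
    × SameCount (λ p → size p ≡ n × 2 ≤ dim p × λ₁ p ≡ λ₂ p + λₘ p + d)
                (λ p → size p ≡ n × k₁ p < kₘ p × λ₁ p ≡ λ₂ p + d)
mainTheorem4 d d≥1 n _ = FirstIdentity.bijection d d≥1 n , SecondIdentity.bijection d d≥1 n
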